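{- For every set of formulas $\Gamma\cup\{A\}$ over $\Sigma_1$: $\Gamma\vdash_{LET_F^+}A$ if and only if $\Gamma\models_{Mat(LET_F^+)}A$.
   Context: Formulas are built from a denumerable set of propositional variables over $\Sigma_1=\{\land,\lor,\neg,\circ\}$. $LET_F^+$ is the natural deduction system with rules: ($\land$I) from $A,B$ infer $A\land B$; ($\land$E) from $A\land B$ infer $A$ and $B$; ($\lor$I) from $A$ (or $B$) infer $A\lor B$; ($\lor$E) from $A\lor B$ and derivations of $C$ from $[A]$ and from $[B]$ infer $C$ (discharging); ($\neg\land$I) from $\neg A$ (or $\neg B$) infer $\neg(A\land B)$; ($\neg\land$E) from $\neg(A\land B)$ and derivations of $C$ from $[\neg A]$ and from $[\neg B]$ infer $C$; ($\neg\lor$I) from $\neg A,\neg B$ infer $\neg(A\lor B)$; ($\neg\lor$E) from $\neg(A\lor B)$ infer $\neg A$ and $\neg B$; (DN) $A$ and $\neg\neg A$ inter-derivable; (EXP$^\circ$) from $\circ A,A,\neg A$ infer $B$; (PEM$^\circ$) from $\circ A$ infer $A\lor\neg A$; and, writing $A^T$ for $\circ A\land A$ and $A^F$ for $\circ A\land\neg A$: (I$\circ$) axiom $\circ\circ A$; (I$\neg\circ$) from $\circ A$ infer $\circ\neg A$; (E$\neg\circ$) from $\circ\neg A$ infer $\circ A$; (I$\land$T) from $A^T,B^T$ infer $(A\land B)^T$; (I$\land$F) from $A^F$ (or $B^F$) infer $(A\land B)^F$; (I$\lor$T) from $A^T$ (or $B^T$) infer $(A\lor B)^T$; (I$\lor$F)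 from $A^F,B^F$ infer $(A\lor B)^F$; (E$\land$T) from $(A\land B)^T$ infer $A^T$ and $B^T$; (E$\land$F) from $(A\land B)^F$ and derivations of $C$ from $[A^F]$ and from $[B^F]$ infer $C$; (E$\lor$T) from $(A\lor B)^T$ and derivations of $C$ from $[A^T]$ and from $[B^T]$ infer $C$; (E$\lor$F) from $(A\lor B)^F$ infer $A^F$ and $B^F$. For a Boolean algebra $\mathcal{B}=\langle\mathbf{B},\sqcap,\sqcup,\Rightarrow,\sim,0,1\rangle$, let $\mathcal{T}^1_\mathcal{B}$ be the algebra over $\Sigma_1$ with domain $\{z\in\mathbf{B}^3:z_3\le z_1\sqcup z_2,\ z_1\sqcap z_2\sqcap z_3=0\}$ and operations $z\tilde\land w=(z_1\sqcap w_1,\ z_2\sqcup w_2,\ (z_1\sqcap z_3\sqcap w_1\sqcap w_3)\sqcup(z_2\sqcap z_3)\sqcup(w_2\sqcap w_3))$; $z\tilde\lor w=(z_1\sqcup w_1,\ z_2\sqcap w_2,\ (z_2\sqcap z_3\sqcap w_2\sqcap w_3)\sqcup(z_1\sqcap z_3)\sqcup(w_1\sqcap w_3))$; $\tilde\neg z=(z_2,z_1,z_3)$; $\tilde\circ z=(z_3,\sim z_3,1)$. $\mathcal{M}^1(\mathcal{B})$ is the logical matrix $\langle\mathcal{T}^1_\mathcal{B},\{z:z_1=1\}\rangle$; $Mat(LET_F^+)$ is the class of all $\mathcal{M}^1(\mathcal{B})$ for Boolean algebras $\mathcal{B}$, and $\Gamma\models_{Mat(LET_F^+)}A$ iff for every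 such matrix and every homomorphism $v$ from formulas into $\mathcal{T}^1_\mathcal{B}$, if $v(B)$ is designated for all $B\in\Gamma$ then $v(A)$ is designated. -}

module Defs where

open import Level using (Level; Setω) renaming (zero to lzero; suc to lsuc)
open import Data.Nat using (ℕ)
open import Data.Product using (_×_; _,_)
open import Data.Sum using (_⊎_)
open import Relation.Binary.PropositionalEquality using (_≡_)
open import Algebra.Lattice.Bundles using (BooleanAlgebra)

infixr 6 _∧'_
infixr 5 _∨'_

data Formula : Set where
  var  : ℕ → Formula
  _∧'_ : Formula → Formula → Formula
  _∨'_ : Formula → Formula → Formula
  ¬'_  : Formula → Formula
  ∘'_  : Formula → Formula

_ᵀ : Formula → Formula
A ᵀ = (∘' A) ∧' A

_ᶠ : Formula → Formula
A ᶠ = (∘' A) ∧' (¬' A)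

Ctx : Set₁
Ctx = Formula → Set

_,,_ : Ctx → Formula → Ctx
(Γ ,, A) X = Γ X ⊎ X ≡ A

infix 3 _⊢_

data _⊢_ : Ctx → Formula → Set₁ where
  hyp   : ∀ {Γ A} → Γ A → Γ ⊢ A
  ∧I    : ∀ {Γ A B} → Γ ⊢ A → Γ ⊢ B → Γ ⊢ A ∧' B
  ∧E₁   : ∀ {Γ A B} → Γ ⊢ A ∧' B → Γ ⊢ A
  ∧E₂   : ∀ {Γ A B} → Γ ⊢ A ∧' B → Γ ⊢ B
  ∨I₁   : ∀ {Γ A B} → Γ ⊢ A → Γ ⊢ A ∨' B
  ∨I₂   : ∀ {Γ A B} → Γ ⊢ B → Γ ⊢ A ∨' B
  ∨E    : ∀ {Γ A B C} → Γ ⊢ A ∨' B → (Γ ,, A) ⊢ C → (Γ ,, B) ⊢ C → Γ ⊢ C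
  ¬∧I₁  : ∀ {Γ A B} → Γ ⊢ ¬' A → Γ ⊢ ¬' (A ∧' B)
  ¬∧I₂  : ∀ {Γ A B} → Γ ⊢ ¬' B → Γ ⊢ ¬' (A ∧' B)
  ¬∧E   : ∀ {Γ A B C} → Γ ⊢ ¬' (A ∧' B) → (Γ ,, (¬' A)) ⊢ C → (Γ ,, (¬' B)) ⊢ C → Γ ⊢ C
  ¬∨I   : ∀ {Γ A B} → Γ ⊢ ¬' A → Γ ⊢ ¬' B → Γ ⊢ ¬' (A ∨' B)
  ¬∨E₁  : ∀ {Γ A B} → Γ ⊢ ¬' (A ∨' B) → Γ ⊢ ¬' A
  ¬∨E₂  : ∀ {Γ A B} → Γ ⊢ ¬' (A ∨' B) → Γ ⊢ ¬' B
  DNI   : ∀ {Γ A} → Γ ⊢ A → Γ ⊢ ¬' ¬' A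
  DNE   : ∀ {Γ A} → Γ ⊢ ¬' ¬' A → Γ ⊢ A
  EXP∘  : ∀ {Γ A B} → Γ ⊢ ∘' A → Γ ⊢ A → Γ ⊢ ¬' A → Γ ⊢ B
  PEM∘  : ∀ {Γ A} → Γ ⊢ ∘' A → Γ ⊢ A ∨' (¬' A)
  I∘    : ∀ {Γ A} → Γ ⊢ ∘' ∘' A
  I¬∘   : ∀ {Γ A} → Γ ⊢ ∘' A → Γ ⊢ ∘' ¬' A
  E¬∘   : ∀ {Γ A} → Γ ⊢ ∘' ¬' A → Γ ⊢ ∘' A
  I∧T   : ∀ {Γ A B} → Γ ⊢ A ᵀ → Γ ⊢ B ᵀ → Γ ⊢ (A ∧' B) ᵀ
  I∧F₁  : ∀ {Γ A B} → Γ ⊢ A ᶠ → Γ ⊢ (A ∧' B) ᶠ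
  I∧F₂  : ∀ {Γ A B} → Γ ⊢ B ᶠ → Γ ⊢ (A ∧' B) ᶠ
  I∨T₁  : ∀ {Γ A B} → Γ ⊢ A ᵀ → Γ ⊢ (A ∨' B) ᵀ
  I∨T₂  : ∀ {Γ A B} → Γ ⊢ B ᵀ → Γ ⊢ (A ∨' B) ᵀ
  I∨F   : ∀ {Γ A B} → Γ ⊢ A ᶠ → Γ ⊢ B ᶠ → Γ ⊢ (A ∨' B) ᶠ
  E∧T₁  : ∀ {Γ A B} → Γ ⊢ (A ∧' B) ᵀ → Γ ⊢ A ᵀ
  E∧T₂  : ∀ {Γ A B} → Γ ⊢ (A ∧' B) ᵀ → Γ ⊢ B ᵀ
  E∧F   : ∀ {Γ A B C} → Γ ⊢ (A ∧' B) ᶠ → (Γ ,, (A ᶠ)) ⊢ C → (Γ ,, (B ᶠ)) ⊢ C → Γ ⊢ C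
  E∨T   : ∀ {Γ A B C} → Γ ⊢ (A ∨' B) ᵀ → (Γ ,, (A ᵀ)) ⊢ C → (Γ ,, (B ᵀ)) ⊢ C → Γ ⊢ C
  E∨F₁  : ∀ {Γ A B} → Γ ⊢ (A ∨' B) ᶠ → Γ ⊢ A ᶠ
  E∨F₂  : ∀ {Γ A B} → Γ ⊢ (A ∨' B) ᶠ → Γ ⊢ B ᶠ

module Matrix {c ℓ : Level} (𝔹 : BooleanAlgebra c ℓ) where
  open BooleanAlgebra 𝔹

  _≤ᴮ_ : Carrier → Carrier → Set ℓ
  x ≤ᴮ y = (x ∧ y) ≈ x

  Triple : Set c
  Triple = Carrier × Carrier × Carrier

  InDomain : Triple → Set ℓ
  InDomain (z₁ , z₂ , z₃) = (z₃ ≤ᴮ (z₁ ∨ z₂)) × ((z₁ ∧ z₂ ∧ z₃) ≈ ⊥)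

  _∧̃_ : Triple → Triple → Triple
  (z₁ , z₂ , z₃) ∧̃ (w₁ , w₂ , w₃) =
    ( z₁ ∧ w₁
    , z₂ ∨ w₂
    , ((z₁ ∧ z₃ ∧ w₁ ∧ w₃) ∨ (z₂ ∧ z₃)) ∨ (w₂ ∧ w₃) )

  _∨̃_ : Triple → Triple → Triple
  (z₁ , z₂ , z₃) ∨̃ (w₁ , w₂ , w₃) =
    ( z₁ ∨ w₁
    , z₂ ∧ w₂
    , ((z₂ ∧ z₃ ∧ w₂ ∧ w₃) ∨ (z₁ ∧ z₃)) ∨ (w₁ ∧ w₃) )

  ¬̃ : Triple → Triple
  ¬̃ (z₁ , z₂ , z₃) = (z₂ , z₁ , z₃)

  ∘̃ : Triple → Triple
  ∘̃ (z₁ , z₂ , z₃) = (z₃ , ¬ z₃ , ⊤)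

  Designated : Triple → Set ℓ
  Designated (z₁ , _ , _) = z₁ ≈ ⊤

  -- A homomorphism from the formula algebra into T¹_B is uniquely
  -- determined by an assignment of domain elements to the variables.
  record Assignment : Set (c Level.⊔ ℓ) where
    field
      val       : ℕ → Triple
      valInDom  : ∀ n → InDomain (val n)

  ⟦_⟧ : Formula → (ℕ → Triple) → Triple
  ⟦ var n ⟧  ρ = ρ n
  ⟦ A ∧' B ⟧ ρ = ⟦ A ⟧ ρ ∧̃ ⟦ B ⟧ ρ
  ⟦ A ∨' B ⟧ ρ = ⟦ A ⟧ ρ ∨̃ ⟦ B ⟧ ρ
  ⟦ ¬' A ⟧   ρ = ¬̃ (⟦ A ⟧ ρ)
  ⟦ ∘' A ⟧   ρ = ∘̃ (⟦ A ⟧ ρ)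

  _⊨ᴮ_ : Ctx → Formula → Set (c Level.⊔ ℓ)
  Γ ⊨ᴮ A = (v : Assignment) →
           (∀ B → Γ B → Designated (⟦ B ⟧ (Assignment.val v))) →
           Designated (⟦ A ⟧ (Assignment.val v))

-- Γ ⊨_{Mat(LET_F^+)} A : consequence in every matrix M¹(B), B ranging over
-- all Boolean algebras (at every universe level).
infix 3 _⊨_
_⊨_ : Ctx → Formula → Setω
Γ ⊨ A = ∀ {c ℓ} (𝔹 : BooleanAlgebra c ℓ) → Matrix._⊨ᴮ_ 𝔹 Γ A

record _⇔ω_ (P : Set₁) (Q : Setω) : Setω where
  field
    to   : P → Q
    from : Q → P

{-# OPTIONS --safe #-}
-- Soundness: in any Boolean algebra, read a derivation of A from Γ as "every u below
-- the first components of the premises is below the first component of A".  Each rule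
-- then becomes a Boolean entailment; those for ∘ hold because every value (z₁, z₂, z₃)
-- satisfies z₃ ≤ z₁ ⊔ z₂ and z₁ ⊓ z₂ ⊓ z₃ = 0, which the operations preserve.
--
-- Completeness: for fixed Γ and C, take as elements the upward-closed sets of contexts Δ
-- (hypotheses added to Γ), let Δ refute x when every extension of Δ lying in x derives C,
-- and order by x ≤ y iff x ⊆ ∼∼y.  This continuation construction is a Boolean algebra,
-- constructively.  Valuing each variable p as (T p, T ¬p, T ∘p), where T X is the set of
-- Δ with Γ ∪ Δ ⊢ X, every formula A gets value (T A, T ¬A, T ∘A) up to equivalence.  The
-- premises are then designated, hence so is T C, which at the empty context is Γ ⊢ C.
module Submission where

open import Level using (Lift; lift) renaming (_⊔_ to _⊔ℓ_)
open import Data.Nat using (ℕ)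
open import Data.Product using (_×_; _,_; proj₁; proj₂; swap)
open import Data.Sum using (_⊎_; inj₁; inj₂; [_,_]; map₁; map₂) renaming (map to ⊎-map)
open import Data.Unit using (tt) renaming (⊤ to Unit)
open import Data.Empty using () renaming (⊥ to Empty)
open import Function using (_∘_; id)
open import Relation.Binary.Core using (Rel)
open import Relation.Binary.Bundles using (Setoid)
open import Relation.Binary.Structures using (IsPartialOrder)
open import Relation.Binary.PropositionalEquality using () renaming (refl to ≡-refl)
open import Relation.Unary using (_⊆′_; _∪_; ∅)
open import Relation.Unary.Properties using (⊆′-refl; ⊆′-trans)
open import Data.Product.Relation.Binary.Pointwise.NonDependent using (×-setoid)
open import Algebra.Core using (Op₁; Op₂)
open import Algebra.Lattice.Bundles using (BooleanAlgebra)
import Algebra.Lattice.Properties.BooleanAlgebra as BooleanAlgebraProperties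
import Algebra.Lattice.Properties.Lattice as LatticeProperties
import Relation.Binary.Lattice as Order
import Relation.Binary.Lattice.Properties.Lattice as OrderLatticeProperties
import Relation.Binary.Lattice.Properties.DistributiveLattice as OrderDistributiveLatticeProperties
open import Defs

,,-mono : ∀ {Γ Δ A} → Γ ⊆′ Δ → (Γ ,, A) ⊆′ (Δ ,, A)
,,-mono Γ⊆Δ B = map₁ (Γ⊆Δ B)

weaken : ∀ {Γ Δ A} → Γ ⊆′ Δ → Γ ⊢ A → Δ ⊢ A
weaken s (hyp g)       = hyp (s _ g)
weaken s (∧I d e)      = ∧I (weaken s d) (weaken s e)
weaken s (∧E₁ d)       = ∧E₁ (weaken s d)
weaken s (∧E₂ d)       = ∧E₂ (weaken s d)
weaken s (∨I₁ d)       = ∨I₁ (weaken s d)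
weaken s (∨I₂ d)       = ∨I₂ (weaken s d)
weaken s (∨E d e f)    = ∨E (weaken s d) (weaken (,,-mono s) e) (weaken (,,-mono s) f)
weaken s (¬∧I₁ d)      = ¬∧I₁ (weaken s d)
weaken s (¬∧I₂ d)      = ¬∧I₂ (weaken s d)
weaken s (¬∧E d e f)   = ¬∧E (weaken s d) (weaken (,,-mono s) e) (weaken (,,-mono s) f)
weaken s (¬∨I d e)     = ¬∨I (weaken s d) (weaken s e)
weaken s (¬∨E₁ d)      = ¬∨E₁ (weaken s d)
weaken s (¬∨E₂ d)      = ¬∨E₂ (weaken s d)
weaken s (DNI d)       = DNI (weaken s d)
weaken s (DNE d)       = DNE (weaken s d)
weaken s (EXP∘ d e f)  = EXP∘ (weaken s d) (weaken s e) (weaken s f)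
weaken s (PEM∘ d)      = PEM∘ (weaken s d)
weaken s I∘            = I∘
weaken s (I¬∘ d)       = I¬∘ (weaken s d)
weaken s (E¬∘ d)       = E¬∘ (weaken s d)
weaken s (I∧T d e)     = I∧T (weaken s d) (weaken s e)
weaken s (I∧F₁ d)      = I∧F₁ (weaken s d)
weaken s (I∧F₂ d)      = I∧F₂ (weaken s d)
weaken s (I∨T₁ d)      = I∨T₁ (weaken s d)
weaken s (I∨T₂ d)      = I∨T₂ (weaken s d)
weaken s (I∨F d e)     = I∨F (weaken s d) (weaken s e)
weaken s (E∧T₁ d)      = E∧T₁ (weaken s d)
weaken s (E∧T₂ d)      = E∧T₂ (weaken s d)
weaken s (E∧F d e f)   = E∧F (weaken s d) (weaken (,,-mono s) e) (weaken (,,-mono s) f)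
weaken s (E∨T d e f)   = E∨T (weaken s d) (weaken (,,-mono s) e) (weaken (,,-mono s) f)
weaken s (E∨F₁ d)      = E∨F₁ (weaken s d)
weaken s (E∨F₂ d)      = E∨F₂ (weaken s d)

∧-swap : ∀ {Θ A B} → Θ ⊢ A ∧' B → Θ ⊢ B ∧' A
∧-swap d = ∧I (∧E₂ d) (∧E₁ d)

∧₄-intro : ∀ {Θ A B P Q} → Θ ⊢ ∘' A ∧' P → Θ ⊢ ∘' B ∧' Q → Θ ⊢ P ∧' ∘' A ∧' Q ∧' ∘' B
∧₄-intro d e = ∧I (∧E₂ d) (∧I (∧E₁ d) (∧-swap e))

∧₄-elimˡ : ∀ {Θ A B P Q} → Θ ⊢ P ∧' ∘' A ∧' Q ∧' ∘' B → Θ ⊢ ∘' A ∧' P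
∧₄-elimˡ d = ∧I (∧E₁ (∧E₂ d)) (∧E₁ d)

∧₄-elimʳ : ∀ {Θ A B P Q} → Θ ⊢ P ∧' ∘' A ∧' Q ∧' ∘' B → Θ ⊢ ∘' B ∧' Q
∧₄-elimʳ d = ∧-swap (∧E₂ (∧E₂ d))

module BooleanAlgebraOfPreorder
  {a ℓ} {A : Set a} (_≤_ : Rel A ℓ) (_∨_ _∧_ : Op₂ A) (¬_ : Op₁ A) (⊤ ⊥ : A)
  (≤-refl : ∀ {x} → x ≤ x) (≤-trans : ∀ {x y z} → x ≤ y → y ≤ z → x ≤ z)
  (x∧y≤x : ∀ {x y} → (x ∧ y) ≤ x) (x∧y≤y : ∀ {x y} → (x ∧ y) ≤ y)
  (∧-greatest : ∀ {x y z} → z ≤ x → z ≤ y → z ≤ (x ∧ y))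
  (x≤x∨y : ∀ {x y} → x ≤ (x ∨ y)) (y≤x∨y : ∀ {x y} → y ≤ (x ∨ y))
  (∨-least : ∀ {x y z} → x ≤ z → y ≤ z → (x ∨ y) ≤ z)
  (∧-distribˡ-∨-≤ : ∀ {x y z} → (x ∧ (y ∨ z)) ≤ ((x ∧ y) ∨ (x ∧ z)))
  (¬-antitone : ∀ {x y} → x ≤ y → (¬ y) ≤ (¬ x))
  (x≤⊤ : ∀ {x} → x ≤ ⊤) (⊥≤x : ∀ {x} → ⊥ ≤ x)
  (⊤≤x∨¬x : ∀ {x} → ⊤ ≤ (x ∨ (¬ x))) (x∧¬x≤⊥ : ∀ {x} → (x ∧ (¬ x)) ≤ ⊥)
  where

  infix 4 _≈_
  _≈_ : Rel A ℓ
  x ≈ y = x ≤ y × y ≤ x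

  isPartialOrder : IsPartialOrder _≈_ _≤_
  isPartialOrder = record
    { isPreorder = record
      { isEquivalence = record
        { refl  = ≤-refl , ≤-refl
        ; sym   = swap
        ; trans = λ (p , q) (r , s) → ≤-trans p r , ≤-trans s q
        }
      ; reflexive = proj₁
      ; trans     = ≤-trans
      }
    ; antisym = _,_
    }

  distributiveLattice : Order.DistributiveLattice a ℓ ℓ
  distributiveLattice = record
    { isDistributiveLattice = record
      { isLattice = record
        { isPartialOrder = isPartialOrder
        ; supremum       = λ _ _ → x≤x∨y , y≤x∨y , λ _ → ∨-least
        ; infimum        = λ _ _ → x∧y≤x , x∧y≤y , λ _ → ∧-greatest
        }
      ; ∧-distribˡ-∨ = λ _ _ _ →
          ∧-distribˡ-∨-≤ , ∨-least (∧-greatest x∧y≤x (≤-trans x∧y≤y x≤x∨y))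
                                   (∧-greatest x∧y≤x (≤-trans x∧y≤y y≤x∨y))
      }
    }

  open Order.DistributiveLattice distributiveLattice using (lattice)
  open OrderLatticeProperties lattice using (isAlgLattice)
  open OrderDistributiveLatticeProperties distributiveLattice using (∨-distrib-∧; ∧-distrib-∨)

  booleanAlgebra : BooleanAlgebra a ℓ
  booleanAlgebra = record
    { Carrier = A
    ; _≈_ = _≈_
    ; _∨_ = _∨_
    ; _∧_ = _∧_
    ; ¬_  = ¬_
    ; ⊤   = ⊤
    ; ⊥   = ⊥
    ; isBooleanAlgebra = record
      { isDistributiveLattice = record
        { isLattice   = isAlgLattice
        ; ∨-distrib-∧ = ∨-distrib-∧
        ; ∧-distrib-∨ = ∧-distrib-∨
        }
      ; ∨-complement = (λ _ → x≤⊤ , ≤-trans ⊤≤x∨¬x (∨-least y≤x∨y x≤x∨y)) , (λ _ → x≤⊤ , ⊤≤x∨¬x)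
      ; ∧-complement = (λ _ → ≤-trans (∧-greatest x∧y≤y x∧y≤x) x∧¬x≤⊥ , ⊥≤x) , (λ _ → x∧¬x≤⊥ , ⊥≤x)
      ; ¬-cong       = λ (p , q) → ¬-antitone q , ¬-antitone p
      }
    }

  x≤y⇒x∧y≈x : ∀ {x y} → x ≤ y → (x ∧ y) ≈ x
  x≤y⇒x∧y≈x x≤y = x∧y≤x , ∧-greatest ≤-refl x≤y

module BooleanAlgebraReasoning {c ℓ} (𝔹 : BooleanAlgebra c ℓ) where
  open BooleanAlgebra 𝔹 hiding (reflexive)
  open BooleanAlgebraProperties 𝔹 using (∧-identityʳ; ∧-zeroˡ)
  open Order.Lattice (LatticeProperties.∨-∧-orderTheoreticLattice lattice) public
    using (_≤_; reflexive; antisym; x∧y≤x; x∧y≤y; x≤x∨y; y≤x∨y; ∨-least)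
    renaming (trans to ≤-trans; ∧-greatest to ∧-intro)

  private variable
    u a b t : Carrier

  -- Stated below an arbitrary u, these are the rules of classical natural deduction.

  ∧-elimˡ : u ≤ a ∧ b → u ≤ a
  ∧-elimˡ p = ≤-trans p (x∧y≤x _ _)

  ∧-elimʳ : u ≤ a ∧ b → u ≤ b
  ∧-elimʳ p = ≤-trans p (x∧y≤y _ _)

  ∨-introˡ : u ≤ a → u ≤ a ∨ b
  ∨-introˡ p = ≤-trans p (x≤x∨y _ _)

  ∨-introʳ : u ≤ b → u ≤ a ∨ b
  ∨-introʳ p = ≤-trans p (y≤x∨y _ _)

  ∨-elim : u ≤ a ∨ b → (∀ {v} → v ≤ u → v ≤ a → v ≤ t) → (∀ {v} → v ≤ u → v ≤ b → v ≤ t) → u ≤ t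
  ∨-elim {u} {a} {b} p left right =
    ≤-trans (reflexive (trans p (∧-distribˡ-∨ u a b)))
            (∨-least (left (x∧y≤x _ _) (x∧y≤y _ _)) (right (x∧y≤x _ _) (x∧y≤y _ _)))

  ⊥-elim : u ≤ ⊥ → u ≤ a
  ⊥-elim {a = a} p = ≤-trans p (sym (∧-zeroˡ a))

  ⊤-intro : u ≤ ⊤
  ⊤-intro {u} = sym (∧-identityʳ u)

  ¬-elim : u ≤ a → u ≤ ¬ a → u ≤ ⊥
  ¬-elim {a = a} p q = ≤-trans (∧-intro p q) (reflexive (∧-complementʳ a))

  excluded-middle : u ≤ a ∨ ¬ a
  excluded-middle {a = a} = ≤-trans ⊤-intro (reflexive (sym (∨-complementʳ a)))

  ⊤≤⇒≈⊤ : ⊤ ≤ a → a ≈ ⊤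
  ⊤≤⇒≈⊤ = antisym ⊤-intro

  ≈⊤⇒⊤≤ : a ≈ ⊤ → ⊤ ≤ a
  ≈⊤⇒⊤≤ p = reflexive (sym p)

module Soundness {c ℓ} (𝔹 : BooleanAlgebra c ℓ) where
  open BooleanAlgebra 𝔹 using (Carrier; _∧_; _∨_; ⊥; sym)
  open BooleanAlgebraReasoning 𝔹
  open Matrix 𝔹

  π₁ π₂ π₃ : Triple → Carrier
  π₁ (z₁ , _ , _) = z₁
  π₂ (_ , z₂ , _) = z₂
  π₃ (_ , _ , z₃) = z₃

  _ᵀ̃ _ᶠ̃ : Triple → Carrier
  z ᵀ̃ = π₁ (∘̃ z ∧̃ z)
  z ᶠ̃ = π₁ (∘̃ z ∧̃ ¬̃ z)

  private variable
    u : Carrier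
    z w : Triple

  record Dom (z : Triple) : Set (c ⊔ℓ ℓ) where
    field
      pem : ∀ {u} → u ≤ π₃ z → u ≤ π₁ z ∨ π₂ z
      exp : ∀ {u} → u ≤ π₁ z → u ≤ π₂ z → u ≤ π₃ z → u ≤ ⊥
  open Dom

  -- Defs orders by x ∧ y ≈ x, the library by x ≈ x ∧ y.
  InDomain⇒Dom : InDomain z → Dom z
  InDomain⇒Dom (z₃≤z₁∨z₂ , z₁∧z₂∧z₃≈⊥) = record
    { pem = λ p → ≤-trans p (sym z₃≤z₁∨z₂)
    ; exp = λ p q r → ≤-trans (∧-intro p (∧-intro q r)) (reflexive z₁∧z₂∧z₃≈⊥)
    }

  ∧̃-ᵀ-intro : u ≤ z ᵀ̃ → u ≤ w ᵀ̃ → u ≤ (z ∧̃ w) ᵀ̃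
  ∧̃-ᵀ-intro p q = ∧-intro
    (∨-introˡ (∨-introˡ (∧-intro (∧-elimʳ p) (∧-intro (∧-elimˡ p) (∧-intro (∧-elimʳ q) (∧-elimˡ q))))))
    (∧-intro (∧-elimʳ p) (∧-elimʳ q))

  ∧̃-ᶠ-introˡ : u ≤ z ᶠ̃ → u ≤ (z ∧̃ w) ᶠ̃
  ∧̃-ᶠ-introˡ p = ∧-intro (∨-introˡ (∨-introʳ (∧-intro (∧-elimʳ p) (∧-elimˡ p)))) (∨-introˡ (∧-elimʳ p))

  ∧̃-ᶠ-introʳ : u ≤ w ᶠ̃ → u ≤ (z ∧̃ w) ᶠ̃
  ∧̃-ᶠ-introʳ p = ∧-intro (∨-introʳ (∧-intro (∧-elimʳ p) (∧-elimˡ p))) (∨-introʳ (∧-elimʳ p))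

  ∧̃-∘-elim : Dom z → Dom w → u ≤ π₃ (z ∧̃ w) → u ≤ π₁ z → u ≤ π₁ w → u ≤ π₃ z ∧ π₃ w
  ∧̃-∘-elim dz dw p z₁ w₁ = ∨-elim p
    (λ v≤u q → ∨-elim q
      (λ _ r → ∧-intro (∧-elimˡ (∧-elimʳ r)) (∧-elimʳ (∧-elimʳ (∧-elimʳ r))))
      (λ v′≤v r → ⊥-elim (exp dz (≤-trans v′≤v (≤-trans v≤u z₁)) (∧-elimˡ r) (∧-elimʳ r))))
    (λ v≤u r → ⊥-elim (exp dw (≤-trans v≤u w₁) (∧-elimˡ r) (∧-elimʳ r)))

  ∧̃-ᵀ-elimˡ : Dom z → Dom w → u ≤ (z ∧̃ w) ᵀ̃ → u ≤ z ᵀ̃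
  ∧̃-ᵀ-elimˡ dz dw p = let z₁∧w₁ = ∧-elimʳ p in
    ∧-intro (∧-elimˡ (∧̃-∘-elim dz dw (∧-elimˡ p) (∧-elimˡ z₁∧w₁) (∧-elimʳ z₁∧w₁))) (∧-elimˡ z₁∧w₁)

  ∧̃-ᵀ-elimʳ : Dom z → Dom w → u ≤ (z ∧̃ w) ᵀ̃ → u ≤ w ᵀ̃
  ∧̃-ᵀ-elimʳ dz dw p = let z₁∧w₁ = ∧-elimʳ p in
    ∧-intro (∧-elimʳ (∧̃-∘-elim dz dw (∧-elimˡ p) (∧-elimˡ z₁∧w₁) (∧-elimʳ z₁∧w₁))) (∧-elimʳ z₁∧w₁)

  ¬̃-dom : Dom z → Dom (¬̃ z)
  ¬̃-dom dz = record
    { pem = λ p → ∨-elim (pem dz p) (λ _ → ∨-introʳ) (λ _ → ∨-introˡ)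
    ; exp = λ p q → exp dz q p
    }

  ∘̃-dom : ∀ z → Dom (∘̃ z)
  ∘̃-dom _ = record { pem = λ _ → excluded-middle ; exp = λ p q _ → ¬-elim p q }

  ∧̃-dom : Dom z → Dom w → Dom (z ∧̃ w)
  ∧̃-dom dz dw = record
    { pem = λ p → ∨-elim p
        (λ v≤u q → ∨-elim q
          (λ _ r → ∨-introˡ (∧-intro (∧-elimˡ r) (∧-elimˡ (∧-elimʳ (∧-elimʳ r)))))
          (λ _ r → ∨-introʳ (∨-introˡ (∧-elimˡ r))))
        (λ _ r → ∨-introʳ (∨-introʳ (∧-elimˡ r)))
    ; exp = λ p q r → let z₃∧w₃ = ∧̃-∘-elim dz dw r (∧-elimˡ p) (∧-elimʳ p) in ∨-elim q
        (λ v≤u z₂ → exp dz (≤-trans v≤u (∧-elimˡ p)) z₂ (≤-trans v≤u (∧-elimˡ z₃∧w₃)))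
        (λ v≤u w₂ → exp dw (≤-trans v≤u (∧-elimʳ p)) w₂ (≤-trans v≤u (∧-elimʳ z₃∧w₃)))
    }

  ∧̃-ᶠ-elim : Dom z → Dom w → u ≤ (z ∧̃ w) ᶠ̃ → u ≤ z ᶠ̃ ∨ w ᶠ̃
  ∧̃-ᶠ-elim dz dw p = ∨-elim (∧-elimˡ p)
    (λ v≤u q → ∨-elim q
      (λ v′≤v r → ⊥-elim (exp (∧̃-dom dz dw)
        (∧-intro (∧-elimˡ r) (∧-elimˡ (∧-elimʳ (∧-elimʳ r))))
        (≤-trans (≤-trans v′≤v v≤u) (∧-elimʳ p))
        (≤-trans (≤-trans v′≤v v≤u) (∧-elimˡ p))))
      (λ _ r → ∨-introˡ (∧-intro (∧-elimʳ r) (∧-elimˡ r))))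
    (λ _ r → ∨-introʳ (∧-intro (∧-elimʳ r) (∧-elimˡ r)))

  -- z ∨̃ w is definitionally ¬̃ (¬̃ z ∧̃ ¬̃ w) and ¬̃ exchanges ᵀ̃ with ᶠ̃, so the ∨̃ lemmas are
  -- the ∧̃ lemmas at ¬̃ z, ¬̃ w.
  ∨̃-dom : Dom z → Dom w → Dom (z ∨̃ w)
  ∨̃-dom dz dw = ¬̃-dom (∧̃-dom (¬̃-dom dz) (¬̃-dom dw))

  ∨̃-ᵀ-introˡ : u ≤ z ᵀ̃ → u ≤ (z ∨̃ w) ᵀ̃
  ∨̃-ᵀ-introˡ {z = z} {w = w} = ∧̃-ᶠ-introˡ {z = ¬̃ z} {w = ¬̃ w}

  ∨̃-ᵀ-introʳ : u ≤ w ᵀ̃ → u ≤ (z ∨̃ w) ᵀ̃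
  ∨̃-ᵀ-introʳ {w = w} {z = z} = ∧̃-ᶠ-introʳ {w = ¬̃ w} {z = ¬̃ z}

  ∨̃-ᶠ-intro : u ≤ z ᶠ̃ → u ≤ w ᶠ̃ → u ≤ (z ∨̃ w) ᶠ̃
  ∨̃-ᶠ-intro {z = z} {w = w} = ∧̃-ᵀ-intro {z = ¬̃ z} {w = ¬̃ w}

  ∨̃-ᵀ-elim : Dom z → Dom w → u ≤ (z ∨̃ w) ᵀ̃ → u ≤ z ᵀ̃ ∨ w ᵀ̃
  ∨̃-ᵀ-elim dz dw = ∧̃-ᶠ-elim (¬̃-dom dz) (¬̃-dom dw)

  ∨̃-ᶠ-elimˡ : Dom z → Dom w → u ≤ (z ∨̃ w) ᶠ̃ → u ≤ z ᶠ̃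
  ∨̃-ᶠ-elimˡ dz dw = ∧̃-ᵀ-elimˡ (¬̃-dom dz) (¬̃-dom dw)

  ∨̃-ᶠ-elimʳ : Dom z → Dom w → u ≤ (z ∨̃ w) ᶠ̃ → u ≤ w ᶠ̃
  ∨̃-ᶠ-elimʳ dz dw = ∧̃-ᵀ-elimʳ (¬̃-dom dz) (¬̃-dom dw)

  module _ (ρ : ℕ → Triple) (ρ-dom : ∀ n → InDomain (ρ n)) where

    ⟦⟧-dom : ∀ A → Dom (⟦ A ⟧ ρ)
    ⟦⟧-dom (var n)  = InDomain⇒Dom (ρ-dom n)
    ⟦⟧-dom (A ∧' B) = ∧̃-dom (⟦⟧-dom A) (⟦⟧-dom B)
    ⟦⟧-dom (A ∨' B) = ∨̃-dom (⟦⟧-dom A) (⟦⟧-dom B)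
    ⟦⟧-dom (¬' A)   = ¬̃-dom (⟦⟧-dom A)
    ⟦⟧-dom (∘' A)   = ∘̃-dom (⟦ A ⟧ ρ)

    ⟦_⟧₁ : Formula → Carrier
    ⟦ A ⟧₁ = π₁ (⟦ A ⟧ ρ)

    record _≤⋀_ (u : Carrier) (Γ : Ctx) : Set ℓ where
      constructor ≤⋀-intro
      field ≤⋀-elim : ∀ {B} → Γ B → u ≤ ⟦ B ⟧₁
    open _≤⋀_

    ≤⋀-,, : ∀ {Γ A v} → u ≤⋀ Γ → v ≤ u → v ≤ ⟦ A ⟧₁ → v ≤⋀ (Γ ,, A)
    ≤⋀-,, u≤Γ v≤u v≤A = ≤⋀-intro λ where
      (inj₁ B∈Γ) → ≤-trans v≤u (≤⋀-elim u≤Γ B∈Γ)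
      (inj₂ ≡-refl) → v≤A

    sound : ∀ {Γ A} → Γ ⊢ A → u ≤⋀ Γ → u ≤ ⟦ A ⟧₁
    sound (hyp A∈Γ)   u≤Γ = ≤⋀-elim u≤Γ A∈Γ
    sound (∧I d e)    u≤Γ = ∧-intro (sound d u≤Γ) (sound e u≤Γ)
    sound (∧E₁ d)     u≤Γ = ∧-elimˡ (sound d u≤Γ)
    sound (∧E₂ d)     u≤Γ = ∧-elimʳ (sound d u≤Γ)
    sound (∨I₁ d)     u≤Γ = ∨-introˡ (sound d u≤Γ)
    sound (∨I₂ d)     u≤Γ = ∨-introʳ (sound d u≤Γ)
    sound (∨E d e f)  u≤Γ = ∨-elim (sound d u≤Γ)
      (λ v≤u v≤A → sound e (≤⋀-,, u≤Γ v≤u v≤A)) (λ v≤u v≤B → sound f (≤⋀-,, u≤Γ v≤u v≤B))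
    sound (¬∧I₁ d)    u≤Γ = ∨-introˡ (sound d u≤Γ)
    sound (¬∧I₂ d)    u≤Γ = ∨-introʳ (sound d u≤Γ)
    sound (¬∧E d e f) u≤Γ = ∨-elim (sound d u≤Γ)
      (λ v≤u v≤A → sound e (≤⋀-,, u≤Γ v≤u v≤A)) (λ v≤u v≤B → sound f (≤⋀-,, u≤Γ v≤u v≤B))
    sound (¬∨I d e)   u≤Γ = ∧-intro (sound d u≤Γ) (sound e u≤Γ)
    sound (¬∨E₁ d)    u≤Γ = ∧-elimˡ (sound d u≤Γ)
    sound (¬∨E₂ d)    u≤Γ = ∧-elimʳ (sound d u≤Γ)
    sound (DNI d)     u≤Γ = sound d u≤Γ
    sound (DNE d)     u≤Γ = sound d u≤Γ
    sound (EXP∘ {A = A} d e f) u≤Γ = ⊥-elim (exp (⟦⟧-dom A) (sound e u≤Γ) (sound f u≤Γ) (sound d u≤Γ))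
    sound (PEM∘ {A = A} d)     u≤Γ = pem (⟦⟧-dom A) (sound d u≤Γ)
    sound I∘          u≤Γ = ⊤-intro
    sound (I¬∘ d)     u≤Γ = sound d u≤Γ
    sound (E¬∘ d)     u≤Γ = sound d u≤Γ
    sound (I∧T d e)   u≤Γ = ∧̃-ᵀ-intro (sound d u≤Γ) (sound e u≤Γ)
    sound (I∧F₁ d)    u≤Γ = ∧̃-ᶠ-introˡ (sound d u≤Γ)
    sound (I∧F₂ d)    u≤Γ = ∧̃-ᶠ-introʳ (sound d u≤Γ)
    sound (I∨T₁ d)    u≤Γ = ∨̃-ᵀ-introˡ (sound d u≤Γ)
    sound (I∨T₂ d)    u≤Γ = ∨̃-ᵀ-introʳ (sound d u≤Γ)
    sound (I∨F d e)   u≤Γ = ∨̃-ᶠ-intro (sound d u≤Γ) (sound e u≤Γ)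
    sound (E∧T₁ {A = A} {B} d) u≤Γ = ∧̃-ᵀ-elimˡ (⟦⟧-dom A) (⟦⟧-dom B) (sound d u≤Γ)
    sound (E∧T₂ {A = A} {B} d) u≤Γ = ∧̃-ᵀ-elimʳ (⟦⟧-dom A) (⟦⟧-dom B) (sound d u≤Γ)
    sound (E∧F {A = A} {B} d e f) u≤Γ = ∨-elim (∧̃-ᶠ-elim (⟦⟧-dom A) (⟦⟧-dom B) (sound d u≤Γ))
      (λ v≤u v≤A → sound e (≤⋀-,, u≤Γ v≤u v≤A)) (λ v≤u v≤B → sound f (≤⋀-,, u≤Γ v≤u v≤B))
    sound (E∨T {A = A} {B} d e f) u≤Γ = ∨-elim (∨̃-ᵀ-elim (⟦⟧-dom A) (⟦⟧-dom B) (sound d u≤Γ))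
      (λ v≤u v≤A → sound e (≤⋀-,, u≤Γ v≤u v≤A)) (λ v≤u v≤B → sound f (≤⋀-,, u≤Γ v≤u v≤B))
    sound (E∨F₁ {A = A} {B} d) u≤Γ = ∨̃-ᶠ-elimˡ (⟦⟧-dom A) (⟦⟧-dom B) (sound d u≤Γ)
    sound (E∨F₂ {A = A} {B} d) u≤Γ = ∨̃-ᶠ-elimʳ (⟦⟧-dom A) (⟦⟧-dom B) (sound d u≤Γ)

soundness : ∀ {Γ A} → Γ ⊢ A → Γ ⊨ A
soundness d 𝔹 v Γ-designated =
  ⊤≤⇒≈⊤ (sound val valInDom d (≤⋀-intro λ {B} B∈Γ → ≈⊤⇒⊤≤ (Γ-designated B B∈Γ)))
  where
  open Matrix.Assignment v
  open Soundness 𝔹 using (sound; ≤⋀-intro)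
  open BooleanAlgebraReasoning 𝔹 using (⊤≤⇒≈⊤; ≈⊤⇒⊤≤)

module TripleCongruence {c ℓ} (𝔹 : BooleanAlgebra c ℓ) where
  open BooleanAlgebra 𝔹
  open Matrix 𝔹

  triple-setoid : Setoid c ℓ
  triple-setoid = ×-setoid setoid (×-setoid setoid setoid)

  open Setoid triple-setoid public using () renaming (_≈_ to _≈₃_; sym to ≈₃-sym; trans to ≈₃-trans)

  ∧̃-cong : ∀ {z z′ w w′} → z ≈₃ z′ → w ≈₃ w′ → (z ∧̃ w) ≈₃ (z′ ∧̃ w′)
  ∧̃-cong (p₁ , p₂ , p₃) (q₁ , q₂ , q₃) =
    ∧-cong p₁ q₁ , ∨-cong p₂ q₂ ,
    ∨-cong (∨-cong (∧-cong p₁ (∧-cong p₃ (∧-cong q₁ q₃))) (∧-cong p₂ p₃)) (∧-cong q₂ q₃)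

  ¬̃-cong : ∀ {z z′} → z ≈₃ z′ → ¬̃ z ≈₃ ¬̃ z′
  ¬̃-cong (p₁ , p₂ , p₃) = p₂ , p₁ , p₃

  ∨̃-cong : ∀ {z z′ w w′} → z ≈₃ z′ → w ≈₃ w′ → (z ∨̃ w) ≈₃ (z′ ∨̃ w′)
  ∨̃-cong p q = ¬̃-cong (∧̃-cong (¬̃-cong p) (¬̃-cong q))

  ∘̃-cong : ∀ {z z′} → z ≈₃ z′ → ∘̃ z ≈₃ ∘̃ z′
  ∘̃-cong (_ , _ , p₃) = p₃ , ¬-cong p₃ , refl

module Canonical (Γ : Ctx) (C : Formula) where

  private variable
    Δ Δ′ : Ctx

  ∪-monoʳ : Δ ⊆′ Δ′ → (Γ ∪ Δ) ⊆′ (Γ ∪ Δ′)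
  ∪-monoʳ s X = map₂ (s X)

  record UpSet : Set₂ where
    field
      holds : Ctx → Set₁
      mono  : Δ ⊆′ Δ′ → holds Δ → holds Δ′
  open UpSet

  T : Formula → UpSet
  T X .holds Δ = Γ ∪ Δ ⊢ X
  T X .mono s = weaken (∪-monoʳ s)

  record Refutes (x : UpSet) (Δ : Ctx) : Set₁ where
    constructor refutes
    field at : Δ ⊆′ Δ′ → holds x Δ′ → holds (T C) Δ′
  open Refutes

  ∼_ : UpSet → UpSet
  (∼ x) .holds = Refutes x
  (∼ x) .mono s n = refutes λ s′ → at n (⊆′-trans s s′)

  infixr 7 _⊓_
  infixr 6 _⊔_
  _⊓_ _⊔_ : UpSet → UpSet → UpSet
  (x ⊓ y) .holds Δ = holds (∼ ∼ x) Δ × holds (∼ ∼ y) Δ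
  (x ⊓ y) .mono s (p , q) = mono (∼ ∼ x) s p , mono (∼ ∼ y) s q
  (x ⊔ y) .holds Δ = holds x Δ ⊎ holds y Δ
  (x ⊔ y) .mono s = ⊎-map (mono x s) (mono y s)

  ⊤ᵁ ⊥ᵁ : UpSet
  ⊤ᵁ = record { holds = λ _ → Lift _ Unit ; mono = λ _ t → t }
  ⊥ᵁ = record { holds = λ _ → Lift _ Empty ; mono = λ _ () }

  infix 4 _≤_
  record _≤_ (x y : UpSet) : Set₁ where
    constructor ≤-intro
    field ≤-elim : holds x Δ → holds (∼ ∼ y) Δ
  open _≤_

  private variable
    x y z : UpSet

  return : holds x Δ → holds (∼ ∼ x) Δ
  return {x = x} xΔ = refutes λ s k → at k ⊆′-refl (mono x s xΔ)

  bind : holds (∼ ∼ x) Δ → (∀ {Δ′} → Δ ⊆′ Δ′ → holds x Δ′ → holds (∼ ∼ y) Δ′) → holds (∼ ∼ y) Δ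
  bind {y = y} j f = refutes λ s k →
    at j s (refutes λ s′ xΔ″ → at (f (⊆′-trans s s′) xΔ″) ⊆′-refl (mono (∼ y) s′ k))

  refute : holds (T C) Δ → holds (∼ ∼ x) Δ
  refute c = refutes λ s _ → mono (T C) s c

  ≤-refl : x ≤ x
  ≤-refl = ≤-intro return

  ≤-trans : x ≤ y → y ≤ z → x ≤ z
  ≤-trans x≤y y≤z = ≤-intro λ xΔ → bind (≤-elim x≤y xΔ) (λ _ → ≤-elim y≤z)

  x⊓y≤x : x ⊓ y ≤ x
  x⊓y≤x = ≤-intro proj₁

  x⊓y≤y : x ⊓ y ≤ y
  x⊓y≤y = ≤-intro proj₂

  ⊓-greatest : z ≤ x → z ≤ y → z ≤ x ⊓ y
  ⊓-greatest z≤x z≤y = ≤-intro λ zΔ → return (≤-elim z≤x zΔ , ≤-elim z≤y zΔ)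

  x≤x⊔y : x ≤ x ⊔ y
  x≤x⊔y = ≤-intro λ xΔ → return (inj₁ xΔ)

  y≤x⊔y : y ≤ x ⊔ y
  y≤x⊔y = ≤-intro λ yΔ → return (inj₂ yΔ)

  ⊔-least : x ≤ z → y ≤ z → x ⊔ y ≤ z
  ⊔-least x≤z y≤z = ≤-intro [ ≤-elim x≤z , ≤-elim y≤z ]

  ⊓-distribˡ-⊔-≤ : x ⊓ (y ⊔ z) ≤ (x ⊓ y) ⊔ (x ⊓ z)
  ⊓-distribˡ-⊔-≤ {x = x} = ≤-intro λ (jx , jy⊔z) → bind jy⊔z λ s →
    [ (λ yΔ → return (inj₁ (mono (∼ ∼ x) s jx , return yΔ)))
    , (λ zΔ → return (inj₂ (mono (∼ ∼ x) s jx , return zΔ))) ]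

  ∼-antitone : x ≤ y → ∼ y ≤ ∼ x
  ∼-antitone {y = y} x≤y = ≤-intro λ ∼y →
    return (refutes λ s xΔ′ → at (≤-elim x≤y xΔ′) ⊆′-refl (mono (∼ y) s ∼y))

  x≤⊤ : x ≤ ⊤ᵁ
  x≤⊤ = ≤-intro λ _ → return (lift tt)

  ⊥≤x : ⊥ᵁ ≤ x
  ⊥≤x = ≤-intro λ ()

  ⊤≤x⊔∼x : ⊤ᵁ ≤ x ⊔ (∼ x)
  ⊤≤x⊔∼x = ≤-intro λ _ → refutes λ s k →
    at k ⊆′-refl (inj₂ (refutes λ s′ xΔ″ → at k s′ (inj₁ xΔ″)))

  x⊓∼x≤⊥ : x ⊓ (∼ x) ≤ ⊥ᵁ
  x⊓∼x≤⊥ = ≤-intro λ (jx , j∼x) → refutes λ s _ →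
    at j∼x s (refutes λ s′ ∼x → at jx (⊆′-trans s s′) ∼x)

  open BooleanAlgebraOfPreorder _≤_ _⊔_ _⊓_ ∼_ ⊤ᵁ ⊥ᵁ ≤-refl ≤-trans x⊓y≤x x⊓y≤y ⊓-greatest
    x≤x⊔y y≤x⊔y ⊔-least ⊓-distribˡ-⊔-≤ ∼-antitone x≤⊤ ⊥≤x ⊤≤x⊔∼x x⊓∼x≤⊥
    using (_≈_; booleanAlgebra; x≤y⇒x∧y≈x)

  open BooleanAlgebra booleanAlgebra using (refl; sym; trans; ∧-cong; ∨-cong)
  open Matrix booleanAlgebra using (Triple; InDomain; Assignment; ⟦_⟧; _∧̃_; _∨̃_; ¬̃; ∘̃)
  open TripleCongruence booleanAlgebra using (_≈₃_; ≈₃-sym; ≈₃-trans; ∧̃-cong; ∨̃-cong; ¬̃-cong; ∘̃-cong)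

  private variable
    X Y Z W P Q : Formula

  ⊢⇒≤ : (∀ {Θ} → Θ ⊢ X → Θ ⊢ Y) → T X ≤ T Y
  ⊢⇒≤ f = ≤-intro λ d → return (f d)

  ⊣⊢⇒≈ : (∀ {Θ} → Θ ⊢ X → Θ ⊢ Y) → (∀ {Θ} → Θ ⊢ Y → Θ ⊢ X) → T X ≈ T Y
  ⊣⊢⇒≈ f g = ⊢⇒≤ f , ⊢⇒≤ g

  ∪-,,-assoc : (Γ ∪ (Δ ,, X)) ⊆′ ((Γ ∪ Δ) ,, X)
  ∪-,,-assoc _ = [ inj₁ ∘ inj₁ , [ inj₁ ∘ inj₂ , inj₂ ] ]

  Elim : Formula → Formula → Formula → Set₁
  Elim Z P Q = ∀ {Θ} → Θ ⊢ Z → Θ ,, P ⊢ C → Θ ,, Q ⊢ C → Θ ⊢ C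

  -- A discharging rule becomes case analysis under ∼∼: each case is continued in the
  -- world extended by its discharged hypothesis.
  by-cases : Elim Z P Q → holds (T Z) Δ
           → (∀ {Δ′} → Δ ⊆′ Δ′ → holds (T P) Δ′ → holds (∼ ∼ y) Δ′)
           → (∀ {Δ′} → Δ ⊆′ Δ′ → holds (T Q) Δ′ → holds (∼ ∼ y) Δ′)
           → holds (∼ ∼ y) Δ
  by-cases {Z = Z} {Δ = Δ} {y = y} elim d case-P case-Q =
    refutes λ s k → elim (mono (T Z) s d) (branch case-P s k) (branch case-Q s k)
    where
    branch : ∀ {R Δ′} → (∀ {Δ″} → Δ ⊆′ Δ″ → holds (T R) Δ″ → holds (∼ ∼ y) Δ″)
           → Δ ⊆′ Δ′ → Refutes y Δ′ → (Γ ∪ Δ′) ,, R ⊢ C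
    branch case s k = weaken ∪-,,-assoc
      (at (case (λ X → inj₁ ∘ s X) (hyp (inj₂ (inj₂ ≡-refl)))) ⊆′-refl (mono (∼ y) (λ _ → inj₁) k))

  T-cases : Elim Z P Q → T Z ≤ T P ⊔ T Q
  T-cases elim = ≤-intro λ d → by-cases elim d (λ _ → return ∘ inj₁) (λ _ → return ∘ inj₂)

  T-∧ : T X ⊓ T Y ≈ T (X ∧' Y)
  T-∧ {X = X} {Y = Y} =
      ≤-intro (λ (jX , jY) → bind jX λ s dX → bind (mono (∼ ∼ T Y) s jY) λ s′ dY →
        return (∧I (mono (T X) s′ dX) dY))
    , ⊓-greatest (⊢⇒≤ ∧E₁) (⊢⇒≤ ∧E₂)

  T-∨ : T X ⊔ T Y ≈ T (X ∨' Y)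
  T-∨ = ⊔-least (⊢⇒≤ ∨I₁) (⊢⇒≤ ∨I₂) , T-cases ∨E

  T-¬∧ : T (¬' X) ⊔ T (¬' Y) ≈ T (¬' (X ∧' Y))
  T-¬∧ = ⊔-least (⊢⇒≤ ¬∧I₁) (⊢⇒≤ ¬∧I₂) , T-cases ¬∧E

  T-¬∨ : T (¬' X) ⊓ T (¬' Y) ≈ T (¬' (X ∨' Y))
  T-¬∨ = trans T-∧ (⊣⊢⇒≈ (λ d → ¬∨I (∧E₁ d) (∧E₂ d)) (λ d → ∧I (¬∨E₁ d) (¬∨E₂ d)))

  T-¬¬ : T (¬' ¬' X) ≈ T X
  T-¬¬ = ⊣⊢⇒≈ DNE DNI

  T-∘¬ : T (∘' ¬' X) ≈ T (∘' X)
  T-∘¬ = ⊣⊢⇒≈ E¬∘ I¬∘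

  T-∘∘ : T (∘' ∘' X) ≈ ⊤ᵁ
  T-∘∘ = x≤⊤ , ≤-intro λ _ → return I∘

  T-¬∘ : T (¬' ∘' X) ≈ ∼ T (∘' X)
  T-¬∘ {X = X} =
      ≤-intro (λ d → return (refutes λ s d∘ → EXP∘ I∘ d∘ (mono (T (¬' ∘' X)) s d)))
    , ≤-intro (λ n → by-cases (λ d → ∨E (PEM∘ d)) I∘ (λ s d∘ → refute (at n s d∘)) (λ _ → return))

  T-∘∧ : T (∘' (X ∧' Y)) ≈ (T (X ∧' ∘' X ∧' Y ∧' ∘' Y) ⊔ T (¬' X ∧' ∘' X)) ⊔ T (¬' Y ∧' ∘' Y)
  T-∘∧ {X = X} {Y = Y} =
      ≤-intro (λ d → by-cases (λ d → ∨E (PEM∘ d)) d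
        (λ s dXY → let t = ∧I (mono (T (∘' (X ∧' Y))) s d) dXY in
          return (inj₁ (inj₁ (∧₄-intro (E∧T₁ t) (E∧T₂ t)))))
        (λ s d¬XY → by-cases E∧F (∧I (mono (T (∘' (X ∧' Y))) s d) d¬XY)
          (λ _ xF → return (inj₁ (inj₂ (∧-swap xF))))
          (λ _ yF → return (inj₂ (∧-swap yF)))))
    , ⊔-least (⊔-least (⊢⇒≤ λ d → ∧E₁ (I∧T (∧₄-elimˡ d) (∧₄-elimʳ d)))
                       (⊢⇒≤ λ d → ∧E₁ (I∧F₁ (∧-swap d))))
              (⊢⇒≤ λ d → ∧E₁ (I∧F₂ (∧-swap d)))

  T-∘∨ : T (∘' (X ∨' Y)) ≈ (T (¬' X ∧' ∘' X ∧' ¬' Y ∧' ∘' Y) ⊔ T (X ∧' ∘' X)) ⊔ T (Y ∧' ∘' Y)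
  T-∘∨ {X = X} {Y = Y} =
      ≤-intro (λ d → by-cases (λ d → ∨E (PEM∘ d)) d
        (λ s dXY → by-cases E∨T (∧I (mono (T (∘' (X ∨' Y))) s d) dXY)
          (λ _ xT → return (inj₁ (inj₂ (∧-swap xT))))
          (λ _ yT → return (inj₂ (∧-swap yT))))
        (λ s d¬XY → let f = ∧I (mono (T (∘' (X ∨' Y))) s d) d¬XY in
          return (inj₁ (inj₁ (∧₄-intro (E∨F₁ f) (E∨F₂ f))))))
    , ⊔-least (⊔-least (⊢⇒≤ λ d → ∧E₁ (I∨F (∧₄-elimˡ d) (∧₄-elimʳ d)))
                       (⊢⇒≤ λ d → ∧E₁ (I∨T₁ (∧-swap d))))
              (⊢⇒≤ λ d → ∧E₁ (I∨T₂ (∧-swap d)))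

  T-⊓₄ : T X ⊓ T Y ⊓ T Z ⊓ T W ≈ T (X ∧' Y ∧' Z ∧' W)
  T-⊓₄ = trans (∧-cong refl (∧-cong refl T-∧)) (trans (∧-cong refl T-∧) T-∧)

  T₃ : Formula → Triple
  T₃ X = T X , T (¬' X) , T (∘' X)

  T₃-∧ : T₃ (X ∧' Y) ≈₃ T₃ X ∧̃ T₃ Y
  T₃-∧ = sym T-∧ , sym T-¬∧ , trans T-∘∧ (∨-cong (∨-cong (sym T-⊓₄) (sym T-∧)) (sym T-∧))

  T₃-∨ : T₃ (X ∨' Y) ≈₃ T₃ X ∨̃ T₃ Y
  T₃-∨ = sym T-∨ , sym T-¬∨ , trans T-∘∨ (∨-cong (∨-cong (sym T-⊓₄) (sym T-∧)) (sym T-∧))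

  T₃-¬ : T₃ (¬' X) ≈₃ ¬̃ (T₃ X)
  T₃-¬ = refl , T-¬¬ , T-∘¬

  T₃-∘ : T₃ (∘' X) ≈₃ ∘̃ (T₃ X)
  T₃-∘ = refl , T-¬∘ , T-∘∘

  valuation : ℕ → Triple
  valuation n = T₃ (var n)

  truth : ∀ X → ⟦ X ⟧ valuation ≈₃ T₃ X
  truth (var n)  = refl , refl , refl
  truth (X ∧' Y) = ≈₃-trans (∧̃-cong (truth X) (truth Y)) (≈₃-sym T₃-∧)
  truth (X ∨' Y) = ≈₃-trans (∨̃-cong (truth X) (truth Y)) (≈₃-sym T₃-∨)
  truth (¬' X)   = ≈₃-trans (¬̃-cong (truth X)) (≈₃-sym T₃-¬)
  truth (∘' X)   = ≈₃-trans (∘̃-cong (truth X)) (≈₃-sym T₃-∘)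

  valuation-inDomain : ∀ n → InDomain (valuation n)
  valuation-inDomain n =
      x≤y⇒x∧y≈x (T-cases (λ d → ∨E (PEM∘ d)))
    , ≤-trans (proj₁ (trans (∧-cong refl T-∧) T-∧))
              (≤-intro λ d → refute (EXP∘ (∧E₂ (∧E₂ d)) (∧E₁ d) (∧E₁ (∧E₂ d))))
    , ⊥≤x

  assignment : Assignment
  assignment = record { val = valuation ; valInDom = valuation-inDomain }

  premise-designated : ∀ B → Γ B → proj₁ (⟦ B ⟧ valuation) ≈ ⊤ᵁ
  premise-designated B B∈Γ = trans (proj₁ (truth B)) (x≤⊤ , ≤-intro λ _ → return (hyp (inj₁ B∈Γ)))

  -- The identity shows that ∅ refutes T C, so ∼∼(T C) at ∅ yields a derivation of C.
  ⊤≤TC⇒Γ⊢C : ⊤ᵁ ≤ T C → Γ ⊢ C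
  ⊤≤TC⇒Γ⊢C ⊤≤TC =
    weaken (λ _ → [ id , (λ ()) ]) (at (≤-elim ⊤≤TC {Δ = ∅} (lift tt)) ⊆′-refl (refutes λ _ d → d))

  completeness : Γ ⊨ C → Γ ⊢ C
  completeness Γ⊨C =
    ⊤≤TC⇒Γ⊢C (proj₂ (trans (sym (proj₁ (truth C))) (Γ⊨C booleanAlgebra assignment premise-designated)))

theorem5p3 : (Γ : Ctx) (A : Formula) → (Γ ⊢ A) ⇔ω (Γ ⊨ A)
theorem5p3 Γ A = record { to = soundness ; from = Canonical.completeness Γ A }
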